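{- Every finite directed bipartite graph $\mathbf{G}=(\mathbf{V}_1\cup\mathbf{V}_2,\mathbf{E})$ with $\mathbf{E}\subseteq\mathbf{V}_1\times\mathbf{V}_2$ has an optimal DAG compression $(V,A,E)$ such that $\mathbf{C}(v)\subseteq\mathbf{V}_2$ for all $v\in V\setminus\mathbf{V}_1$.
   Context: $\mathbf{V}_1,\mathbf{V}_2$ are disjoint sets (the shores). A DAG compression of a directed graph $(\mathbf{V},\mathbf{E})$ is a triple $(V,A,E)$ where $(V,A)$ is a directed acyclic graph whose set of sinks (vertices of out-degree $0$) is exactly $\mathbf{V}\subseteq V$; for $v\in V$ the cluster $\mathbf{C}(v)$ is the set of sinks reachable from $v$ in $(V,A)$; and $E\subseteq V\times V$ is a set of compression edges with $\mathbf{E}=\bigcup_{(u,v)\in E}\mathbf{C}(u)\times\mathbf{C}(v)$. Its size is $|A|+|E|$, and it is optimal if no DAG compression of the same graph has smaller size. -}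

module Defs where

open import Data.Nat using (ℕ; _+_; _≤_)
open import Data.Fin using (Fin; _↑ˡ_; _↑ʳ_; splitAt)
open import Data.Bool using (Bool; true; false; if_then_else_)
open import Data.List using (List; map; allFin)
open import Data.Nat.ListAction using (sum)
open import Data.Sum using (_⊎_; inj₁; inj₂)
open import Data.Product using (Σ; ∃; ∃-syntax; _×_; _,_)
open import Relation.Binary.PropositionalEquality using (_≡_)
open import Relation.Nullary using (¬_)
open import Function.Bundles using (_⇔_)

Rel : ℕ → Set
Rel m = Fin m → Fin m → Bool

card : ∀ {m} → Rel m → ℕ
card {m} R = sum (map (λ i → sum (map (λ j → if R i j then 1 else 0) (allFin m))) (allFin m))

data Reach {m} (A : Rel m) : Fin m → Fin m → Set where
  here : ∀ {v} → Reach A v v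
  step : ∀ {u w v} → A u w ≡ true → Reach A w v → Reach A u v

-- The compression's vertex
-- set is Fin (n + k): the graph vertices 𝐕 = Fin n sit inside it via
-- _↑ˡ k, and there are k further (auxiliary) vertices.
record Compression (n : ℕ) : Set where
  field
    k   : ℕ
    arc : Rel (n + k)
    cmp : Rel (n + k)   -- the compression edges E ⊆ V × V

open Compression public

emb : ∀ {n} (D : Compression n) → Fin n → Fin (n + k D)
emb D x = x ↑ˡ k D

IsSink : ∀ {n} (D : Compression n) → Fin (n + k D) → Set
IsSink D v = ∀ w → arc D v w ≡ false

-- the graph vertex x belongs to the cluster 𝐂(v): x is a sink reachable from v
-- (the sinks are exactly the graph vertices, by IsDAGCompression below)
InCluster : ∀ {n} (D : Compression n) → Fin n → Fin (n + k D) → Set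
InCluster D x v = Reach (arc D) v (emb D x)

record IsDAGCompression {n} (𝐄 : Rel n) (D : Compression n) : Set where
  field
    acyclic : ∀ u v → arc D u v ≡ true → ¬ Reach (arc D) v u
    sinks   : ∀ v → IsSink D v ⇔ (∃[ x ] v ≡ emb D x)
    covers  : ∀ x y → 𝐄 x y ≡ true ⇔
                (∃[ u ] ∃[ v ] (cmp D u v ≡ true × InCluster D x u × InCluster D y v))

size : ∀ {n} → Compression n → ℕ
size D = card (arc D) + card (cmp D)

IsOptimal : ∀ {n} (𝐄 : Rel n) (D : Compression n) → Set
IsOptimal 𝐄 D = IsDAGCompression 𝐄 D × (∀ D' → IsDAGCompression 𝐄 D' → size D ≤ size D')

-- The directed bipartite graph with shores 𝐕₁ = Fin n₁, 𝐕₂ = Fin n₂, vertex set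
-- Fin (n₁ + n₂) (𝐕₁ = image of _↑ˡ n₂, 𝐕₂ = image of n₁ ↑ʳ_), and edge set
-- contained in 𝐕₁ × 𝐕₂ given by E : Fin n₁ → Fin n₂ → Bool.
bipartite : ∀ n₁ n₂ → (Fin n₁ → Fin n₂ → Bool) → Rel (n₁ + n₂)
bipartite n₁ n₂ E x y with splitAt n₁ x | splitAt n₁ y
... | inj₁ i | inj₂ j = E i j
... | _      | _      = false

InV₁ : ∀ n₁ n₂ (D : Compression (n₁ + n₂)) → Fin (n₁ + n₂ + k D) → Set
InV₁ n₁ n₂ D v = ∃[ i ] v ≡ emb D (i ↑ˡ n₂)

InV₂ : ∀ n₁ n₂ → Fin (n₁ + n₂) → Set
InV₂ n₁ n₂ x = ∃[ j ] x ≡ n₁ ↑ʳ j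

module Submission where

-- An optimal compression exists since a compression of size s has at most s auxiliary
-- vertices (each has an outgoing arc), so compressions of bounded size can be searched
-- exhaustively.  If 𝐕₂ is nonempty, any compression of the bipartite graph can be
-- normalised without growing.  The vertices reaching 𝐕₂ keep their arcs among
-- themselves.  The remaining auxiliary vertices only reach 𝐕₁, and the part of the DAG
-- they span is reversed: an arc s → x into x ∈ 𝐕₁ becomes a compression edge (x , s),
-- an arc b → a becomes an arc a → b, and a compression edge (u , v) leaving such a
-- vertex becomes an arc u → v.  Reversed vertices that lead nowhere get one arc into 𝐕₂.
-- Each new arc or compression edge is paid for by a distinct old one, and afterwards
-- only the vertices of 𝐕₁ reach 𝐕₁.

open import Defs
open import Data.Nat using (ℕ; zero; suc; _+_; _≤_; _<_; z≤n; s≤s)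
open import Data.Nat.Properties as ℕ
  using (≤-refl; ≤-trans; ≤-reflexive; +-mono-≤; +-monoʳ-≤; m≤m+n; m≤n+m; ≮⇒≥; anyUpTo?)
open import Data.Nat.Induction using (<-rec)
import Data.Nat.ListAction as List
open import Data.Fin using (Fin; zero; suc; toℕ; _↑ˡ_; _↑ʳ_; splitAt; cast)
open import Data.Fin.Properties
  using (any?; all?; _≟_; toℕ<n; toℕ-injective; ↑ˡ-injective; splitAt-↑ˡ; splitAt-↑ʳ;
         splitAt⁻¹-↑ˡ; splitAt⁻¹-↑ʳ; toℕ-cast; toℕ-↑ˡ)
open import Data.Bool using (Bool; true; false; _∧_; _∨_; not; if_then_else_)
open import Data.Bool.Properties using (¬-not; not-¬; ∧-zeroʳ; ∨-zeroʳ) renaming (_≟_ to _≟ᵇ_)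
open import Data.List using (allFin; tabulate; map)
open import Data.List.Properties using (map-tabulate)
open import Data.Vec using (Vec; []; _∷_; lookup) renaming (tabulate to tabulateᵥ)
open import Data.Vec.Properties using (lookup∘tabulate)
open import Data.Sum using (_⊎_; inj₁; inj₂)
import Data.Sum
open import Data.Product using (∃; ∃-syntax; _×_; _,_; proj₁; proj₂)
open import Data.Empty using (⊥; ⊥-elim)
open import Function using (_∘_; id)
open import Function.Bundles using (_⇔_; mk⇔; Equivalence)
open import Relation.Binary.PropositionalEquality using (_≡_; _≢_; refl; sym; trans; cong; cong₂; subst)
open import Relation.Nullary using (¬_; Dec; yes; no; does; ¬?)
open import Relation.Nullary.Decidable using (map′; _×-dec_; _→-dec_; dec-true; dec-false)
open import Relation.Unary using (Pred) renaming (Decidable to Decidable¹)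
open import Algebra.Properties.CommutativeMonoid.Sum ℕ.+-0-commutativeMonoid
  using (sum; sum-cong-≗; ∑-distrib-+; ∑-comm; sum-replicate-zero)

𝟙 : Bool → ℕ
𝟙 b = if b then 1 else 0

sum-tabulate : ∀ {m} (f : Fin m → ℕ) → List.sum (tabulate f) ≡ sum f
sum-tabulate {zero}  f = refl
sum-tabulate {suc m} f = cong (f zero +_) (sum-tabulate (f ∘ suc))

sum-map-allFin : ∀ {m} (f : Fin m → ℕ) → List.sum (map f (allFin m)) ≡ sum f
sum-map-allFin {m} f = trans (cong List.sum (map-tabulate id f)) (sum-tabulate f)

sum₂ : ∀ {m} → (Fin m → Fin m → ℕ) → ℕ
sum₂ f = sum (λ u → sum (f u))

card-sum : ∀ {m} (R : Rel m) → card R ≡ sum₂ (λ u v → 𝟙 (R u v))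
card-sum {m} R = trans (sum-map-allFin (λ u → List.sum (map (𝟙 ∘ R u) (allFin m))))
                       (sum-cong-≗ λ u → sum-map-allFin (𝟙 ∘ R u))

sum-mono-≤ : ∀ {m} {f g : Fin m → ℕ} → (∀ i → f i ≤ g i) → sum f ≤ sum g
sum-mono-≤ {zero}  f≤g = z≤n
sum-mono-≤ {suc m} f≤g = +-mono-≤ (f≤g zero) (sum-mono-≤ (f≤g ∘ suc))

≤-sum : ∀ {m} (f : Fin m → ℕ) i → f i ≤ sum f
≤-sum f zero    = m≤m+n _ _
≤-sum f (suc i) = ≤-trans (≤-sum (f ∘ suc) i) (m≤n+m _ _)

sum-↑ʳ-≤ : ∀ m {k} (f : Fin (m + k) → ℕ) → sum (f ∘ (m ↑ʳ_)) ≤ sum f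
sum-↑ʳ-≤ zero    f = ≤-refl
sum-↑ʳ-≤ (suc m) f = ≤-trans (sum-↑ʳ-≤ m (f ∘ suc)) (m≤n+m _ _)

size≤sum : ∀ {m} (f : Fin m → ℕ) → (∀ i → 1 ≤ f i) → m ≤ sum f
size≤sum {zero}  f pos = z≤n
size≤sum {suc m} f pos = +-mono-≤ (pos zero) (size≤sum (f ∘ suc) (pos ∘ suc))

sum₂-mono-≤ : ∀ {m} {f g : Fin m → Fin m → ℕ} → (∀ u v → f u v ≤ g u v) → sum₂ f ≤ sum₂ g
sum₂-mono-≤ f≤g = sum-mono-≤ λ u → sum-mono-≤ (f≤g u)

sum₂-distrib-+ : ∀ {m} (f g : Fin m → Fin m → ℕ) → sum₂ (λ u v → f u v + g u v) ≡ sum₂ f + sum₂ g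
sum₂-distrib-+ f g = trans (sum-cong-≗ λ u → ∑-distrib-+ (f u) (g u)) (∑-distrib-+ (sum ∘ f) (sum ∘ g))

sum-indicator : ∀ {m} (y : Fin m) → sum (λ x → 𝟙 (does (x ≟ y))) ≡ 1
sum-indicator {suc m} zero    = cong suc (sum-replicate-zero m)
sum-indicator {suc m} (suc y) = sum-indicator y

module _ {m} {A : Rel m} where

  infixr 5 _◅◅_
  _◅◅_ : ∀ {u w v} → Reach A u w → Reach A w v → Reach A u v
  here     ◅◅ q = q
  step a p ◅◅ q = step a (p ◅◅ q)

  _▻_ : ∀ {u w v} → Reach A u w → A w v ≡ true → Reach A u v
  p ▻ a = p ◅◅ step a here

  Reach-unsnoc : ∀ {u v} → Reach A u v → v ≡ u ⊎ ∃[ w ] (Reach A u w × A w v ≡ true)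
  Reach-unsnoc here       = inj₁ refl
  Reach-unsnoc (step a p) with Reach-unsnoc p
  ... | inj₁ refl           = inj₂ (_ , here , a)
  ... | inj₂ (w , p′ , a′) = inj₂ (w , step a p′ , a′)

  Reach-from-sink : ∀ {u v} → (∀ w → A u w ≡ false) → Reach A u v → v ≡ u
  Reach-from-sink sink here       = refl
  Reach-from-sink sink (step a p) with () ← trans (sym a) (sink _)

Reach-map : ∀ {m} {A B : Rel m} → (∀ u v → A u v ≡ true → B u v ≡ true) →
            ∀ {u v} → Reach A u v → Reach B u v
Reach-map A⊆B here       = here
Reach-map A⊆B (step a p) = step (A⊆B _ _ a) (Reach-map A⊆B p)

-- Reachability is decided Floyd–Warshall style: Via k u v are the paths from
-- u to v whose intermediate vertices all have index below k.
module _ {m} (A : Rel m) where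

  data Via : ℕ → Fin m → Fin m → Set where
    stay    : ∀ {k v} → Via k v v
    hop     : ∀ {k u v} → A u v ≡ true → Via k u v
    below   : ∀ {k u v} → Via k u v → Via (suc k) u v
    through : ∀ {k u v} w → toℕ w ≡ k → Via k u w → Via k w v → Via (suc k) u v

  Via⇒Reach : ∀ {k u v} → Via k u v → Reach A u v
  Via⇒Reach stay              = here
  Via⇒Reach (hop a)           = step a here
  Via⇒Reach (below p)         = Via⇒Reach p
  Via⇒Reach (through _ _ p q) = Via⇒Reach p ◅◅ Via⇒Reach q

  Via-unfold : ∀ {k u v} → Via (suc k) u v → Via k u v ⊎ ∃[ w ] (toℕ w ≡ k × Via k u w × Via k w v)
  Via-unfold stay                = inj₁ stay
  Via-unfold (hop a)             = inj₁ (hop a)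
  Via-unfold (below p)           = inj₁ p
  Via-unfold (through w w≡k p q) = inj₂ (w , w≡k , p , q)

  Via-lower-to : ∀ {k u w} → toℕ w ≡ k → Via (suc k) u w → Via k u w
  Via-lower-to w≡k p with Via-unfold p
  ... | inj₁ p′ = p′
  ... | inj₂ (w′ , w′≡k , p₁ , _) with refl ← toℕ-injective (trans w′≡k (sym w≡k)) = p₁

  Via-lower-from : ∀ {k w v} → toℕ w ≡ k → Via (suc k) w v → Via k w v
  Via-lower-from w≡k p with Via-unfold p
  ... | inj₁ p′ = p′
  ... | inj₂ (w′ , w′≡k , _ , p₂) with refl ← toℕ-injective (trans w′≡k (sym w≡k)) = p₂

  Via-trans : ∀ k {u w v} → Via k u w → Via k w v → toℕ w < k → Via k u v
  Via-trans (suc k) {w = w} p q (s≤s w≤k) with ℕ.m≤n⇒m<n∨m≡n w≤k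
  ... | inj₂ w≡k = through w w≡k (Via-lower-to w≡k p) (Via-lower-from w≡k q)
  ... | inj₁ w<k with Via-unfold p | Via-unfold q
  ...   | inj₁ p′ | inj₁ q′ = below (Via-trans k p′ q′ w<k)
  ...   | inj₁ p′ | inj₂ (w₂ , e₂ , q₁ , q₂) = through w₂ e₂ (Via-trans k p′ q₁ w<k) q₂
  ...   | inj₂ (w₁ , e₁ , p₁ , p₂) | inj₁ q′ = through w₁ e₁ p₁ (Via-trans k p₂ q′ w<k)
  ...   | inj₂ (w₁ , e₁ , p₁ , _) | inj₂ (w₂ , e₂ , _ , q₂)
        with refl ← toℕ-injective (trans e₁ (sym e₂)) = through w₁ e₁ p₁ q₂

  Reach⇒Via : ∀ {u v} → Reach A u v → Via m u v
  Reach⇒Via here       = stay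
  Reach⇒Via (step a p) = Via-trans m (hop a) (Reach⇒Via p) (toℕ<n _)

  Via? : ∀ k u v → Dec (Via k u v)
  Via? zero u v with u ≟ v | A u v ≟ᵇ true
  ... | yes refl | _     = yes stay
  ... | no _     | yes a = yes (hop a)
  ... | no u≢v   | no ¬a = no λ { stay → u≢v refl ; (hop a) → ¬a a }
  Via? (suc k) u v
    with Via? k u v | any? (λ w → (toℕ w ℕ.≟ k) ×-dec (Via? k u w ×-dec Via? k w v))
  ... | yes p | _                    = yes (below p)
  ... | no _  | yes (w , e , p , q) = yes (through w e p q)
  ... | no ¬p | no ¬q = no λ { stay → ¬p stay ; (hop a) → ¬p (hop a) ; (below p) → ¬p p
                             ; (through w e p q) → ¬q (w , e , p , q) }

Reach? : ∀ {m} (A : Rel m) u v → Dec (Reach A u v)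
Reach? {m} A u v = map′ (Via⇒Reach A) (Reach⇒Via A) (Via? A m u v)

-- Exhaustive search

Exhaustible : Set → Set₁
Exhaustible X = ∀ {P : Pred X _} → Decidable¹ P → Dec (∃ P)

Bool-exhaustible : Exhaustible Bool
Bool-exhaustible P? with P? true | P? false
... | yes p | _     = yes (true , p)
... | no _  | yes p = yes (false , p)
... | no ¬t | no ¬f = no λ { (true , p) → ¬t p ; (false , p) → ¬f p }

Vec-exhaustible : ∀ {X} → Exhaustible X → ∀ n → Exhaustible (Vec X n)
Vec-exhaustible X? zero    P? with P? []
... | yes p = yes ([] , p)
... | no ¬p = no λ { ([] , p) → ¬p p }
Vec-exhaustible X? (suc n) P? with X? (λ x → Vec-exhaustible X? n (λ xs → P? (x ∷ xs)))
... | yes (x , xs , p) = yes (x ∷ xs , p)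
... | no ¬p            = no λ { (x ∷ xs , p) → ¬p (x , xs , p) }

_≐_ : ∀ {m} → Rel m → Rel m → Set
R ≐ S = ∀ u v → R u v ≡ S u v

-- The search runs over matrices of values, so P must respect pointwise equality.
∃-Rel? : ∀ {m} {P : Rel m → Set} → (∀ {R S} → R ≐ S → P R → P S) → Decidable¹ P → Dec (∃ P)
∃-Rel? {m} {P} resp P? =
  map′ (λ (M , p) → toRel M , p) (λ (R , p) → fromRel R , resp (toRel-fromRel R) p)
       (Vec-exhaustible (Vec-exhaustible Bool-exhaustible m) m (P? ∘ toRel))
  where
  toRel : Vec (Vec Bool m) m → Rel m
  toRel M u v = lookup (lookup M u) v
  fromRel : Rel m → Vec (Vec Bool m) m
  fromRel R = tabulateᵥ (tabulateᵥ ∘ R)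
  toRel-fromRel : ∀ R → R ≐ toRel (fromRel R)
  toRel-fromRel R u v =
    sym (trans (cong (λ row → lookup row v) (lookup∘tabulate (tabulateᵥ ∘ R) u))
               (lookup∘tabulate (R u) v))

Minimum : (ℕ → Set) → Set
Minimum P = ∃[ s ] (P s × ∀ t → P t → s ≤ t)

least : {P : ℕ → Set} → Decidable¹ P → ∀ {s} → P s → Minimum P
least {P} P? {s} = <-rec (λ s → P s → Minimum P) go s
  where
  go : ∀ s → (∀ {t} → t < s → P t → Minimum P) → P s → Minimum P
  go s rec p with anyUpTo? P? s
  ... | yes (t , t<s , q) = rec t<s q
  ... | no ¬smaller       = s , p , λ t q → ≮⇒≥ λ t<s → ¬smaller (t , t<s , q)

↑ˡ≢↑ʳ : ∀ {m n} (i : Fin m) (j : Fin n) → i ↑ˡ n ≢ m ↑ʳ j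
↑ˡ≢↑ʳ {m} {n} i j eq with () ← trans (sym (splitAt-↑ˡ m i n)) (trans (cong (splitAt m) eq) (splitAt-↑ʳ m n j))

↑ˡ⊎↑ʳ : ∀ m {n} (x : Fin (m + n)) → (∃[ i ] x ≡ i ↑ˡ n) ⊎ (∃[ j ] x ≡ m ↑ʳ j)
↑ˡ⊎↑ʳ m x with splitAt m x in eq
... | inj₁ i = inj₁ (i , sym (splitAt⁻¹-↑ˡ eq))
... | inj₂ j = inj₂ (j , sym (splitAt⁻¹-↑ʳ eq))

strip : ∀ {n} → Fin (n + 0) → Fin n
strip {n} = cast (ℕ.+-identityʳ n)

strip-↑ˡ : ∀ {n} (x : Fin n) → strip (x ↑ˡ 0) ≡ x
strip-↑ˡ x = toℕ-injective (trans (toℕ-cast _ (x ↑ˡ 0)) (toℕ-↑ˡ x 0))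

↑ˡ-strip : ∀ {n} (u : Fin (n + 0)) → strip u ↑ˡ 0 ≡ u
↑ˡ-strip u = toℕ-injective (trans (toℕ-↑ˡ (strip u) 0) (toℕ-cast _ u))

compression : ∀ {n} k → Rel (n + k) → Rel (n + k) → Compression n
compression k a c = record { k = k ; arc = a ; cmp = c }

card-cong : ∀ {m} {R S : Rel m} → R ≐ S → card R ≡ card S
card-cong {R = R} {S} R≐S =
  trans (card-sum R) (trans (sum-cong-≗ λ u → sum-cong-≗ λ v → cong 𝟙 (R≐S u v)) (sym (card-sum S)))

module _ {n} (𝐄 : Rel n) where

  IsDAGCompression-resp : ∀ {k a a′ c c′} → a ≐ a′ → c ≐ c′ →
    IsDAGCompression 𝐄 (compression k a c) → IsDAGCompression 𝐄 (compression k a′ c′)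
  IsDAGCompression-resp a≐a′ c≐c′ D = record
    { acyclic = λ u v uv vu → acyclic u v (trans (a≐a′ u v) uv) (Reach-map ⊇ vu)
    ; sinks   = λ v → mk⇔ (λ s → to (sinks v) (λ w → trans (a≐a′ v w) (s w)))
                          (λ x w → trans (sym (a≐a′ v w)) (from (sinks v) x w))
    ; covers  = λ x y → mk⇔
        (λ e → let (u , v , c , p , q) = to (covers x y) e
               in u , v , trans (sym (c≐c′ u v)) c , Reach-map ⊆ p , Reach-map ⊆ q)
        (λ (u , v , c , p , q) → from (covers x y) (u , v , trans (c≐c′ u v) c , Reach-map ⊇ p , Reach-map ⊇ q))
    }
    where
    open IsDAGCompression D
    open Equivalence
    ⊆ = λ u v → trans (sym (a≐a′ u v))
    ⊇ = λ u v → trans (a≐a′ u v)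

  isDAGCompression? : Decidable¹ (IsDAGCompression 𝐄)
  isDAGCompression? D =
    map′ (λ (a , s , c) → record { acyclic = a ; sinks = s ; covers = c })
         (λ D → acyclic D , sinks D , covers D)
         (all? (λ u → all? λ v → (arc D u v ≟ᵇ true) →-dec ¬? (Reach? (arc D) v u)) ×-dec
          (all? (λ v → all? (λ w → arc D v w ≟ᵇ false) ⇔? any? (λ x → v ≟ emb D x)) ×-dec
           all? (λ x → all? λ y → (𝐄 x y ≟ᵇ true) ⇔?
             any? (λ u → any? λ v → (cmp D u v ≟ᵇ true) ×-dec
                                     (Reach? (arc D) u (emb D x) ×-dec Reach? (arc D) v (emb D y))))))
    where
    open IsDAGCompression
    _⇔?_ : ∀ {X Y : Set} → Dec X → Dec Y → Dec (X ⇔ Y)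
    X? ⇔? Y? = map′ (λ (f , g) → mk⇔ f g) (λ e → Equivalence.to e , Equivalence.from e) ((X? →-dec Y?) ×-dec (Y? →-dec X?))

  nonsink-arc : ∀ {D} → IsDAGCompression 𝐄 D → ∀ v → ¬ (∃[ x ] v ≡ emb D x) → ∃[ w ] arc D v w ≡ true
  nonsink-arc {D} isD v ¬emb with any? (λ w → arc D v w ≟ᵇ true)
  ... | yes arc = arc
  ... | no ¬arc = ⊥-elim (¬emb (Equivalence.to (IsDAGCompression.sinks isD v) (λ w → ¬-not (λ a → ¬arc (w , a)))))

  k≤size : ∀ {D} → IsDAGCompression 𝐄 D → k D ≤ size D
  k≤size {D} isD = begin
    k D                               ≤⟨ size≤sum (outdeg ∘ (n ↑ʳ_)) outdeg-aux ⟩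
    sum (outdeg ∘ (n ↑ʳ_))            ≤⟨ sum-↑ʳ-≤ n outdeg ⟩
    sum outdeg                        ≡⟨ card-sum (arc D) ⟨
    card (arc D)                      ≤⟨ m≤m+n _ _ ⟩
    size D                            ∎
    where
    open ℕ.≤-Reasoning
    outdeg : Fin (n + k D) → ℕ
    outdeg v = sum (λ w → 𝟙 (arc D v w))
    outdeg-aux : ∀ j → 1 ≤ outdeg (n ↑ʳ j)
    outdeg-aux j with nonsink-arc isD (n ↑ʳ j) (λ (x , e) → ↑ˡ≢↑ʳ x j (sym e))
    ... | w , a = ≤-trans (≤-reflexive (cong 𝟙 (sym a))) (≤-sum _ w)

  trivial : Compression n
  trivial = compression 0 (λ _ _ → false) (λ u v → 𝐄 (strip u) (strip v))

  trivial-isDAGCompression : IsDAGCompression 𝐄 trivial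
  trivial-isDAGCompression = record
    { acyclic = λ u v ()
    ; sinks   = λ v → mk⇔ (λ _ → strip v , sym (↑ˡ-strip v)) (λ _ _ → refl)
    ; covers  = λ x y → mk⇔
        (λ e → x ↑ˡ 0 , y ↑ˡ 0 , subst (_≡ true) (sym (cong₂ 𝐄 (strip-↑ˡ x) (strip-↑ˡ y))) e , here , here)
        (λ (u , v , c , p , q) → covered c (Reach-from-sink (λ _ → refl) p) (Reach-from-sink (λ _ → refl) q))
    }
    where
    covered : ∀ {x y u v} → 𝐄 (strip u) (strip v) ≡ true → x ↑ˡ 0 ≡ u → y ↑ˡ 0 ≡ v → 𝐄 x y ≡ true
    covered c refl refl = subst (_≡ true) (cong₂ 𝐄 (strip-↑ˡ _) (strip-↑ˡ _)) c

  FitsIn : ℕ → ℕ → Set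
  FitsIn s k = ∃[ a ] ∃[ c ] (IsDAGCompression 𝐄 (compression k a c) × size (compression k a c) ≤ s)

  Compressible : ℕ → Set
  Compressible s = ∃[ k ] (k < suc s × FitsIn s k)

  compressible? : Decidable¹ Compressible
  compressible? s = anyUpTo? fitsIn? (suc s)
    where
    fitsIn? : ∀ k → Dec (FitsIn s k)
    fitsIn? k = ∃-Rel? (λ a≐a′ (c , p) → c , fits-resp a≐a′ (λ _ _ → refl) p) λ a →
                ∃-Rel? (fits-resp (λ _ _ → refl)) λ c →
                isDAGCompression? (compression k a c) ×-dec (size (compression k a c) ℕ.≤? s)
      where
      fits-resp : ∀ {a a′ c c′} → a ≐ a′ → c ≐ c′ →
             IsDAGCompression 𝐄 (compression k a c) × size (compression k a c) ≤ s →
             IsDAGCompression 𝐄 (compression k a′ c′) × size (compression k a′ c′) ≤ s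
      fits-resp a≐a′ c≐c′ (D , D≤s) =
        IsDAGCompression-resp a≐a′ c≐c′ D ,
        subst (_≤ s) (cong₂ _+_ (card-cong a≐a′) (card-cong c≐c′)) D≤s

  compressible : ∀ {D} → IsDAGCompression 𝐄 D → Compressible (size D)
  compressible {D} isD = k D , s≤s (k≤size isD) , arc D , cmp D , isD , ≤-refl

  optimal-exists : ∃ (IsOptimal 𝐄)
  optimal-exists with least compressible? (compressible trivial-isDAGCompression)
  ... | s , (k , _ , a , c , isD , D≤s) , minimal =
    compression k a c , isD , λ D′ isD′ → ≤-trans D≤s (minimal _ (compressible isD′))

module _ {n₁ n₂} (E : Fin n₁ → Fin n₂ → Bool) where

  bipartite-edge : ∀ x y → bipartite n₁ n₂ E x y ≡ true → (∃[ i ] x ≡ i ↑ˡ n₂) × (∃[ j ] y ≡ n₁ ↑ʳ j)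
  bipartite-edge x y e with splitAt n₁ x in ex | splitAt n₁ y in ey
  bipartite-edge x y e  | inj₁ i | inj₂ j = (i , sym (splitAt⁻¹-↑ˡ ex)) , (j , sym (splitAt⁻¹-↑ʳ ey))
  bipartite-edge x y () | inj₁ _ | inj₁ _
  bipartite-edge x y () | inj₂ _ | _

  bipartite-from-V₂ : ∀ j y → bipartite n₁ n₂ E (n₁ ↑ʳ j) y ≡ false
  bipartite-from-V₂ j y rewrite splitAt-↑ʳ n₁ n₂ j = refl

bipartite-empty : ∀ {n₁} (E : Fin n₁ → Fin 0 → Bool) x y → bipartite n₁ 0 E x y ≡ false
bipartite-empty {n₁} E x y with splitAt n₁ x | splitAt n₁ y
... | inj₁ _ | inj₁ _ = refl
... | inj₂ () | _

ClustersInV₂ : ∀ n₁ n₂ → Compression (n₁ + n₂) → Set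
ClustersInV₂ n₁ n₂ D = ∀ v → ¬ InV₁ n₁ n₂ D v → ∀ x → InCluster D x v → InV₂ n₁ n₂ x

∧-true : ∀ {x y} → x ∧ y ≡ true → x ≡ true × y ≡ true
∧-true {true} {true} refl = refl , refl

∧-intro : ∀ {x y} → x ≡ true → y ≡ true → x ∧ y ≡ true
∧-intro refl refl = refl

∨-true : ∀ {x y} → x ∨ y ≡ true → x ≡ true ⊎ y ≡ true
∨-true {true}  _ = inj₁ refl
∨-true {false} e = inj₂ e

does-true : ∀ {P : Set} (P? : Dec P) → does P? ≡ true → P
does-true (yes p) _ = p

-- The arcs of the normalised compression are given by this function of Booleans, so
-- that its size estimates are finite case analyses.
newArc : (inV₁ reaches useful kept out toY : Bool) → Bool
newArc true  _     _     _    _   _   = false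
newArc false true  _     kept _   _   = kept
newArc false false true  _    out _   = out
newArc false false false _    _   toY = toY

𝟙-∧-≤ : ∀ x y → 𝟙 (x ∧ y) ≤ 𝟙 x
𝟙-∧-≤ false _     = z≤n
𝟙-∧-≤ true  false = z≤n
𝟙-∧-≤ true  true  = ≤-refl

𝟙-∧∨-≤ : ∀ c h f → 𝟙 ((c ∧ h) ∨ f) ≤ 𝟙 c + 𝟙 f
𝟙-∧∨-≤ false _     _ = ≤-refl
𝟙-∧∨-≤ true  true  _ = s≤s z≤n
𝟙-∧∨-≤ true  false f = ℕ.n≤1+n (𝟙 f)

-- A vertex spends its out-relation (c ∧ h) ∨ f either on arcs (useful left vertex)
-- or on compression edges (𝐕₁-vertex), never on both.
arc+cmp-≤ : ∀ v r u kept c h f t →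
  𝟙 (newArc v r u kept ((c ∧ h) ∨ f) t) + 𝟙 (v ∧ ((c ∧ h) ∨ f)) ≤ 𝟙 c + (𝟙 (newArc v r u kept false t) + 𝟙 f)
arc+cmp-≤ true  r     u     kept c h f t = 𝟙-∧∨-≤ c h f
arc+cmp-≤ false true  u     kept c h f t = ≤-trans (+-monoʳ-≤ (𝟙 kept) z≤n) (m≤n+m _ (𝟙 c))
arc+cmp-≤ false false true  kept c h f t = ≤-trans (≤-reflexive (ℕ.+-identityʳ _)) (𝟙-∧∨-≤ c h f)
arc+cmp-≤ false false false kept c h f t = ≤-trans (+-monoʳ-≤ (𝟙 t) z≤n) (m≤n+m _ (𝟙 c))

-- Each old arc leaving a vertex pays for at most one new item: itself if kept, its
-- reversal if the vertex is a useful left one, or else the single arc t of a useless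
-- left vertex (which has some arc to pay with).
row-≤ : ∀ {m} v r u (x h t : Fin m → Bool) → (v ≡ false → r ≡ false → ∃[ b ] x b ≡ true) →
  sum (𝟙 ∘ t) ≡ 1 →
  sum (λ b → 𝟙 (newArc v r u (x b ∧ h b) false (t b)) + 𝟙 (x b ∧ ((not v ∧ not r) ∧ u))) ≤ sum (𝟙 ∘ x)
row-≤ true  r     u     x h t _ _ = sum-mono-≤ λ b → 𝟙-∧-≤ (x b) _
row-≤ false true  u     x h t _ _ = sum-mono-≤ λ b →
  subst (λ z → 𝟙 (x b ∧ h b) + 𝟙 z ≤ 𝟙 (x b)) (sym (∧-zeroʳ (x b)))
        (≤-trans (≤-reflexive (ℕ.+-identityʳ _)) (𝟙-∧-≤ (x b) (h b)))
row-≤ false false true  x h t _ _ = sum-mono-≤ λ b → 𝟙-∧-≤ (x b) true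
row-≤ false false false x h t nonsink one with nonsink refl refl
... | w , xw = begin
  sum (λ b → 𝟙 (t b) + 𝟙 (x b ∧ false))  ≡⟨ sum-cong-≗ (λ b → trans (cong (λ z → 𝟙 (t b) + 𝟙 z) (∧-zeroʳ (x b)))
                                                                  (ℕ.+-identityʳ _)) ⟩
  sum (𝟙 ∘ t)                             ≡⟨ one ⟩
  1                                       ≡⟨ cong 𝟙 xw ⟨
  𝟙 (x w)                                 ≤⟨ ≤-sum (𝟙 ∘ x) w ⟩
  sum (𝟙 ∘ x)                             ∎
  where open ℕ.≤-Reasoning

-- Normalising a DAG compression of a bipartite graph

module Normalise {n₁ n₂} (E : Fin n₁ → Fin n₂ → Bool) {D : Compression (n₁ + n₂)}
                 (isD : IsDAGCompression (bipartite n₁ n₂ E) D) (y₀ : Fin n₂) where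

  open IsDAGCompression isD
  open Equivalence using (to; from)

  private
    V = Fin (n₁ + n₂ + k D)
    A = arc D
    C = cmp D

  e₁ : Fin n₁ → V
  e₁ i = emb D (i ↑ˡ n₂)

  e₂ : Fin n₂ → V
  e₂ j = emb D (n₁ ↑ʳ j)

  -- Left vertices are the auxiliary vertices whose clusters lie in 𝐕₁.  Once their arcs
  -- are reversed, a left vertex covers the targets of the compression edges leaving its
  -- left ancestors; it is useful if one of these edges leads into the part reaching 𝐕₂.
  isV₁ reachesV₂ left : V → Bool
  isV₁ a      = does (any? λ i → a ≟ e₁ i)
  reachesV₂ a = does (any? λ j → Reach? A a (e₂ j))
  left a      = not (isV₁ a) ∧ not (reachesV₂ a)

  up : Rel (n₁ + n₂ + k D)
  up a c = A c a ∧ left c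

  useful? : ∀ a → Dec (∃[ c ] (Reach up a c × ∃[ z ] (C c z ∧ reachesV₂ z) ≡ true))
  useful? a = any? λ c → Reach? up a c ×-dec any? λ z → (C c z ∧ reachesV₂ z) ≟ᵇ true

  useful : V → Bool
  useful a = does (useful? a)

  flipped out arc′ cmp′ : Rel (n₁ + n₂ + k D)
  flipped a b = A b a ∧ (left b ∧ useful b)
  out a b     = (C a b ∧ reachesV₂ b) ∨ flipped a b
  arc′ a b    = newArc (isV₁ a) (reachesV₂ a) (useful a) (A a b ∧ reachesV₂ b) (out a b) (does (b ≟ e₂ y₀))
  cmp′ a b    = isV₁ a ∧ out a b

  D′ : Compression (n₁ + n₂)
  D′ = compression (k D) arc′ cmp′

  emb-sink : ∀ x → IsSink D (emb D x)
  emb-sink x = from (sinks (emb D x)) (x , refl)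

  covered : ∀ {x y u v} → C u v ≡ true → Reach A u (emb D x) → Reach A v (emb D y) → bipartite n₁ n₂ E x y ≡ true
  covered c p q = from (covers _ _) (_ , _ , c , p , q)

  e₁≢e₂ : ∀ i j → e₁ i ≢ e₂ j
  e₁≢e₂ i j e = ↑ˡ≢↑ʳ i j (↑ˡ-injective (k D) _ _ e)

  isV₁-e₁ : ∀ i → isV₁ (e₁ i) ≡ true
  isV₁-e₁ i = dec-true (any? _) (i , refl)

  isV₁-e₂ : ∀ j → isV₁ (e₂ j) ≡ false
  isV₁-e₂ j = dec-false (any? _) λ (i , e) → e₁≢e₂ i j (sym e)

  isV₁⇒e₁ : ∀ {a} → isV₁ a ≡ true → ∃[ i ] a ≡ e₁ i
  isV₁⇒e₁ = does-true (any? _)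

  reachesV₂-intro : ∀ {a} j → Reach A a (e₂ j) → reachesV₂ a ≡ true
  reachesV₂-intro j p = dec-true (any? _) (j , p)

  reachesV₂-elim : ∀ {a} → reachesV₂ a ≡ true → ∃[ j ] Reach A a (e₂ j)
  reachesV₂-elim = does-true (any? _)

  reachesV₂-e₂ : ∀ j → reachesV₂ (e₂ j) ≡ true
  reachesV₂-e₂ j = reachesV₂-intro j here

  reachesV₂⇒¬isV₁ : ∀ {a} → reachesV₂ a ≡ true → isV₁ a ≡ false
  reachesV₂⇒¬isV₁ r = ¬-not λ v →
    let (i , a≡e₁) = isV₁⇒e₁ v ; (j , p) = reachesV₂-elim r
    in e₁≢e₂ i j (sym (Reach-from-sink (emb-sink _) (subst (λ a → Reach A a (e₂ j)) a≡e₁ p)))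

  arc⇒¬isV₁ : ∀ {a b} → A a b ≡ true → isV₁ a ≡ false
  arc⇒¬isV₁ {b = b} x = ¬-not λ v → let (i , a≡e₁) = isV₁⇒e₁ v
                                   in not-¬ (subst (λ a → A a b ≡ true) a≡e₁ x) (emb-sink _ b)

  left-intro : ∀ {a} → isV₁ a ≡ false → reachesV₂ a ≡ false → left a ≡ true
  left-intro v r rewrite v | r = refl

  left-elim : ∀ {a} → left a ≡ true → isV₁ a ≡ false × reachesV₂ a ≡ false
  left-elim {a} l with isV₁ a | reachesV₂ a
  left-elim refl | false | false = refl , refl

  emb-¬left : ∀ x → left (emb D x) ≡ true → ⊥
  emb-¬left x l with ↑ˡ⊎↑ʳ n₁ x
  ... | inj₁ (i , refl) = not-¬ (isV₁-e₁ i) (proj₁ (left-elim l))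
  ... | inj₂ (j , refl) = not-¬ (reachesV₂-e₂ j) (proj₂ (left-elim l))

  left-arc : ∀ {a} → left a ≡ true → ∃[ w ] A a w ≡ true
  left-arc {a} l = nonsink-arc _ isD a λ (x , a≡x) → emb-¬left x (subst (λ a → left a ≡ true) a≡x l)

  useful-intro : ∀ {a c z} → Reach up a c → C c z ≡ true → reachesV₂ z ≡ true → useful a ≡ true
  useful-intro {a} p c r = dec-true (useful? a) (_ , p , _ , ∧-intro c r)

  useful-elim : ∀ {a} → useful a ≡ true → ∃[ c ] (Reach up a c × ∃[ z ] (C c z ≡ true × reachesV₂ z ≡ true))
  useful-elim {a} u with does-true (useful? a) u
  ... | c , p , z , cr = c , p , z , ∧-true cr

  data Kind (a : V) : Set where
    inV₁        : isV₁ a ≡ true → Kind a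
    right       : reachesV₂ a ≡ true → Kind a
    usefulLeft  : left a ≡ true → useful a ≡ true → Kind a
    uselessLeft : left a ≡ true → useful a ≡ false → Kind a

  kind : ∀ a → Kind a
  kind a with isV₁ a in v | reachesV₂ a in r | useful a in u
  ... | true  | _     | _     = inV₁ v
  ... | false | true  | _     = right r
  ... | false | false | true  = usefulLeft (left-intro v r) u
  ... | false | false | false = uselessLeft (left-intro v r) u

  data Out (a b : V) : Set where
    cmp-edge : C a b ≡ true → reachesV₂ b ≡ true → Out a b
    reversed : A b a ≡ true → left b ≡ true → useful b ≡ true → Out a b

  out-view : ∀ {a b} → out a b ≡ true → Out a b
  out-view o with ∨-true o
  ... | inj₁ cr = let (c , r) = ∧-true cr in cmp-edge c r
  ... | inj₂ f  = let (x , lu) = ∧-true f ; (l , u) = ∧-true lu in reversed x l u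

  Out⇒out : ∀ {a b} → Out a b → out a b ≡ true
  Out⇒out (cmp-edge c r) rewrite c | r = refl
  Out⇒out (reversed x l u) rewrite x | l | u = ∨-zeroʳ _

  data NewArc (a b : V) : Set where
    kept    : reachesV₂ a ≡ true → A a b ≡ true → reachesV₂ b ≡ true → NewArc a b
    outward : left a ≡ true → useful a ≡ true → Out a b → NewArc a b
    to-y₀   : left a ≡ true → useful a ≡ false → b ≡ e₂ y₀ → NewArc a b

  newArc-view : ∀ {a b} → arc′ a b ≡ true → NewArc a b
  newArc-view {a} {b} e with isV₁ a in v | reachesV₂ a in r | useful a in u
  newArc-view ()  | true  | _     | _
  newArc-view e   | false | true  | _     = let (x , rb) = ∧-true e in kept r x rb
  newArc-view e   | false | false | true  = outward (left-intro v r) u (out-view e)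
  newArc-view {b = b} e | false | false | false = to-y₀ (left-intro v r) u (does-true (b ≟ e₂ y₀) e)

  arc′-kept : ∀ {a b} → reachesV₂ a ≡ true → A a b ≡ true → reachesV₂ b ≡ true → arc′ a b ≡ true
  arc′-kept r x rb rewrite reachesV₂⇒¬isV₁ r | r | x | rb = refl

  arc′-out : ∀ {a b} → left a ≡ true → useful a ≡ true → Out a b → arc′ a b ≡ true
  arc′-out l u o rewrite proj₁ (left-elim l) | proj₂ (left-elim l) | u = Out⇒out o

  arc′-to-y₀ : ∀ {a} → left a ≡ true → useful a ≡ false → arc′ a (e₂ y₀) ≡ true
  arc′-to-y₀ l u rewrite proj₁ (left-elim l) | proj₂ (left-elim l) | u = dec-true (e₂ y₀ ≟ e₂ y₀) refl

  cmp′-view : ∀ {a b} → cmp′ a b ≡ true → isV₁ a ≡ true × Out a b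
  cmp′-view e = let (v , o) = ∧-true e in v , out-view o

  cmp′-intro : ∀ {a b} → isV₁ a ≡ true → Out a b → cmp′ a b ≡ true
  cmp′-intro v o rewrite v = Out⇒out o

  right-path : ∀ {a b} → reachesV₂ a ≡ true → Reach arc′ a b → reachesV₂ b ≡ true × Reach A a b
  right-path r here = r , here
  right-path r (step e p) with newArc-view e
  ... | kept _ x rw    = let (rb , q) = right-path rw p in rb , step x q
  ... | outward l _ _  = ⊥-elim (not-¬ r (proj₂ (left-elim l)))
  ... | to-y₀ l _ _    = ⊥-elim (not-¬ r (proj₂ (left-elim l)))

  left-path : ∀ {a b} → left a ≡ true → useful a ≡ true → Reach arc′ a b → reachesV₂ b ≡ true ⊎ Reach A b a
  left-path l u here = inj₂ here
  left-path l u (step e p) with newArc-view e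
  ... | kept r _ _                     = ⊥-elim (not-¬ r (proj₂ (left-elim l)))
  ... | outward _ _ (cmp-edge _ rw)    = inj₁ (proj₁ (right-path rw p))
  ... | outward _ _ (reversed x lw uw) = Data.Sum.map₂ (_▻ x) (left-path lw uw p)
  ... | to-y₀ _ u′ _                   = ⊥-elim (not-¬ u u′)

  acyclic′ : ∀ a b → arc′ a b ≡ true → ¬ Reach arc′ b a
  acyclic′ a b e p with newArc-view e
  ... | kept _ x rb                    = acyclic a b x (proj₂ (right-path rb p))
  ... | outward l _ (cmp-edge _ rb)    = not-¬ (proj₁ (right-path rb p)) (proj₂ (left-elim l))
  ... | outward l _ (reversed x lb ub) =
        Data.Sum.[ (λ ra → not-¬ ra (proj₂ (left-elim l))) , acyclic b a x ] (left-path lb ub p)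
  ... | to-y₀ l _ refl = not-¬ (proj₁ (right-path (reachesV₂-e₂ y₀) p)) (proj₂ (left-elim l))

  emb-sink′ : ∀ x → IsSink D′ (emb D x)
  emb-sink′ x w with ↑ˡ⊎↑ʳ n₁ x
  ... | inj₁ (i , refl) rewrite isV₁-e₁ i = refl
  ... | inj₂ (j , refl) rewrite isV₁-e₂ j | reachesV₂-e₂ j | emb-sink (n₁ ↑ʳ j) w = refl

  sink′⇒emb : ∀ v → IsSink D′ v → ∃[ x ] v ≡ emb D x
  sink′⇒emb v s with kind v
  ... | inV₁ iv = let (i , e) = isV₁⇒e₁ iv in i ↑ˡ n₂ , e
  ... | right rv with reachesV₂-elim rv
  ...   | j , here     = n₁ ↑ʳ j , refl
  ...   | j , step x p = ⊥-elim (not-¬ (arc′-kept rv x (reachesV₂-intro j p)) (s _))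
  sink′⇒emb v s | usefulLeft l u with useful-elim u
  ... | _ , here , _ , c , rz = ⊥-elim (not-¬ (arc′-out l u (cmp-edge c rz)) (s _))
  ... | _ , step w↑ p , _ , c , rz = let (x , lw) = ∧-true w↑ in
        ⊥-elim (not-¬ (arc′-out l u (reversed x lw (useful-intro p c rz))) (s _))
  sink′⇒emb v s | uselessLeft l u = ⊥-elim (not-¬ (arc′-to-y₀ l u) (s _))

  old-path-to-V₂ : ∀ {a} j → Reach A a (e₂ j) → Reach arc′ a (e₂ j)
  old-path-to-V₂ j here       = here
  old-path-to-V₂ j (step x p) =
    step (arc′-kept (reachesV₂-intro j (step x p)) x (reachesV₂-intro j p)) (old-path-to-V₂ j p)

  cover-source : ∀ {a y} → left a ≡ true → useful a ≡ true → Reach arc′ a (emb D y) →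
                 ∃[ c ] ∃[ z ] (Reach A c a × C c z ≡ true × Reach A z (emb D y))
  cover-source {y = y} l u here = ⊥-elim (emb-¬left y l)
  cover-source l u (step e p) with newArc-view e
  ... | kept r _ _                     = ⊥-elim (not-¬ r (proj₂ (left-elim l)))
  ... | outward _ _ (cmp-edge c rw)    = _ , _ , here , c , proj₂ (right-path rw p)
  ... | outward _ _ (reversed x lw uw) =
        let (c , z , q , cz , t) = cover-source lw uw p in c , z , q ▻ x , cz , t
  ... | to-y₀ _ u′ _                   = ⊥-elim (not-¬ u u′)

  -- An old covering pair (u , v) of the edge (e₁ i , e₂ j), where u reaches e₁ i
  -- through the arc from s.  All vertices on the path from u to s are useful left
  -- vertices, so the reversed path together with the edge (e₁ i , s) covers it anew.
  module Reversal {u v s i j} (c : C u v ≡ true) (q : Reach A v (e₂ j))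
                  (r : Reach A u s) (x : A s (e₁ i) ≡ true) where

    u-¬reachesV₂ : reachesV₂ u ≡ false
    u-¬reachesV₂ = ¬-not λ ru → let (j′ , p) = reachesV₂-elim ru in
      not-¬ (covered c p q) (bipartite-from-V₂ E j′ (n₁ ↑ʳ j))

    between-left : ∀ {w} → Reach A u w → Reach A w s → left w ≡ true
    between-left uw ws = left-intro (has-arc⇒¬isV₁ ws) (¬-not λ rw →
      let (j′ , p) = reachesV₂-elim rw in not-¬ (reachesV₂-intro j′ (uw ◅◅ p)) u-¬reachesV₂)
      where
      has-arc⇒¬isV₁ : ∀ {w} → Reach A w s → isV₁ w ≡ false
      has-arc⇒¬isV₁ here       = arc⇒¬isV₁ x
      has-arc⇒¬isV₁ (step y _) = arc⇒¬isV₁ y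

    up-path : ∀ {a w} → Reach A a w → Reach A u a → Reach A w s → Reach up w a
    up-path here       _  _  = here
    up-path (step y p) ua ws = up-path p (ua ▻ y) ws ▻ ∧-intro y (between-left ua (step y p ◅◅ ws))

    between-useful : ∀ {w} → Reach A u w → Reach A w s → useful w ≡ true
    between-useful uw ws = useful-intro (up-path uw here ws) c (reachesV₂-intro j q)

    reversed-path : ∀ {w} → Reach A u w → Reach A w s → Reach arc′ s w
    reversed-path uw here       = here
    reversed-path uw (step y p) =
      reversed-path (uw ▻ y) p ▻
        arc′-out (between-left (uw ▻ y) p) (between-useful (uw ▻ y) p)
                 (reversed y (between-left uw (step y p)) (between-useful uw (step y p)))

    cover : ∃[ u′ ] ∃[ v′ ] (cmp′ u′ v′ ≡ true × Reach arc′ u′ (e₁ i) × Reach arc′ v′ (e₂ j))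
    cover = e₁ i , s ,
      cmp′-intro (isV₁-e₁ i) (reversed x (between-left r here) (between-useful r here)) , here ,
      reversed-path here r ◅◅
        step (arc′-out (between-left here r) (between-useful here r) (cmp-edge c (reachesV₂-intro j q)))
             (old-path-to-V₂ j q)

  covers-to : ∀ x y → bipartite n₁ n₂ E x y ≡ true →
              ∃[ u ] ∃[ v ] (cmp′ u v ≡ true × Reach arc′ u (emb D x) × Reach arc′ v (emb D y))
  covers-to x y e with bipartite-edge E x y e | to (covers x y) e
  ... | (i , refl) , (j , refl) | u , v , c , p , q with Reach-unsnoc p
  ...   | inj₁ refl        = e₁ i , v , cmp′-intro (isV₁-e₁ i) (cmp-edge c (reachesV₂-intro j q)) , here ,
                             old-path-to-V₂ j q
  ...   | inj₂ (s , r , x) = Reversal.cover c q r x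

  covers-from : ∀ x y → ∃[ u ] ∃[ v ] (cmp′ u v ≡ true × Reach arc′ u (emb D x) × Reach arc′ v (emb D y)) →
                bipartite n₁ n₂ E x y ≡ true
  covers-from x y (u , v , c , p , q) with cmp′-view c
  ... | iu , o with isV₁⇒e₁ iu
  ...   | i , refl with ↑ˡ-injective (k D) _ _ (Reach-from-sink (emb-sink′ (i ↑ˡ n₂)) p)
  ...     | refl with o
  ...       | cmp-edge cc rv = covered cc here (proj₂ (right-path rv q))
  ...       | reversed xx lv uv = let (_ , _ , r , cz , t) = cover-source lv uv q in covered cz (r ▻ xx) t

  D′-isDAGCompression : IsDAGCompression (bipartite n₁ n₂ E) D′
  D′-isDAGCompression = record
    { acyclic = acyclic′
    ; sinks   = λ v → mk⇔ (sink′⇒emb v) λ { (x , refl) → emb-sink′ x }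
    ; covers  = λ x y → mk⇔ (covers-to x y) (covers-from x y)
    }

  arc′-target-¬V₁ : ∀ {a b} → arc′ a b ≡ true → isV₁ b ≡ false
  arc′-target-¬V₁ e with newArc-view e
  ... | kept _ _ rb                  = reachesV₂⇒¬isV₁ rb
  ... | outward _ _ (cmp-edge _ rb)  = reachesV₂⇒¬isV₁ rb
  ... | outward _ _ (reversed _ l _) = proj₁ (left-elim l)
  ... | to-y₀ _ _ refl               = isV₁-e₂ y₀

  D′-clustersInV₂ : ClustersInV₂ n₁ n₂ D′
  D′-clustersInV₂ v ¬inV₁ x p with ↑ˡ⊎↑ʳ n₁ x
  ... | inj₂ (j , refl) = j , refl
  ... | inj₁ (i , refl) with Reach-unsnoc p
  ...   | inj₁ refl        = ⊥-elim (¬inV₁ (i , refl))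
  ...   | inj₂ (_ , _ , e) = ⊥-elim (not-¬ (isV₁-e₁ i) (arc′-target-¬V₁ e))

  -- What the arcs of D′ cost apart from the out-relation: the kept arcs and the arc to y₀.
  charge : Rel (n₁ + n₂ + k D)
  charge a b = newArc (isV₁ a) (reachesV₂ a) (useful a) (A a b ∧ reachesV₂ b) false (does (b ≟ e₂ y₀))

  size-D′-≤ : size D′ ≤ size D
  size-D′-≤ = begin
    card arc′ + card cmp′                                 ≡⟨ cong₂ _+_ (card-sum arc′) (card-sum cmp′) ⟩
    sum₂ arc₁ + sum₂ cmp₁                                 ≡⟨ sum₂-distrib-+ arc₁ cmp₁ ⟨
    sum₂ (λ a b → arc₁ a b + cmp₁ a b)                    ≤⟨ sum₂-mono-≤ pointwise ⟩
    sum₂ (λ a b → C₁ a b + (charge₁ a b + flipped₁ a b))  ≡⟨ sum₂-distrib-+ C₁ _ ⟩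
    sum₂ C₁ + sum₂ (λ a b → charge₁ a b + flipped₁ a b)   ≡⟨ cong (sum₂ C₁ +_) transpose-flipped ⟩
    sum₂ C₁ + sum₂ (λ a b → charge₁ a b + flipped₁ b a)   ≤⟨ +-monoʳ-≤ (sum₂ C₁) (sum-mono-≤ row) ⟩
    sum₂ C₁ + sum₂ A₁                                     ≡⟨ ℕ.+-comm (sum₂ C₁) (sum₂ A₁) ⟩
    sum₂ A₁ + sum₂ C₁                                     ≡⟨ cong₂ _+_ (card-sum A) (card-sum C) ⟨
    card A + card C                                       ∎
    where
    open ℕ.≤-Reasoning
    A₁ C₁ arc₁ cmp₁ charge₁ flipped₁ : Fin (n₁ + n₂ + k D) → Fin (n₁ + n₂ + k D) → ℕ
    A₁ a b       = 𝟙 (A a b)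
    C₁ a b       = 𝟙 (C a b)
    arc₁ a b     = 𝟙 (arc′ a b)
    cmp₁ a b     = 𝟙 (cmp′ a b)
    charge₁ a b  = 𝟙 (charge a b)
    flipped₁ a b = 𝟙 (flipped a b)

    pointwise : ∀ a b → arc₁ a b + cmp₁ a b ≤ C₁ a b + (charge₁ a b + flipped₁ a b)
    pointwise a b = arc+cmp-≤ (isV₁ a) (reachesV₂ a) (useful a) (A a b ∧ reachesV₂ b)
                              (C a b) (reachesV₂ b) (flipped a b) (does (b ≟ e₂ y₀))

    transpose-flipped : sum₂ (λ a b → charge₁ a b + flipped₁ a b) ≡ sum₂ (λ a b → charge₁ a b + flipped₁ b a)
    transpose-flipped =
      trans (sum₂-distrib-+ charge₁ flipped₁)
            (trans (cong (sum₂ charge₁ +_) (∑-comm flipped₁))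
                   (sym (sum₂-distrib-+ charge₁ (λ a b → flipped₁ b a))))

    row : ∀ a → sum (λ b → charge₁ a b + flipped₁ b a) ≤ sum (A₁ a)
    row a = row-≤ (isV₁ a) (reachesV₂ a) (useful a) (A a) reachesV₂ (λ b → does (b ≟ e₂ y₀))
                  (λ v r → left-arc (left-intro v r)) (sum-indicator (e₂ y₀))

card-empty : ∀ {m} (R : Rel m) → (∀ u v → R u v ≡ false) → card R ≡ 0
card-empty {m} R empty =
  trans (card-sum R)
        (trans (sum-cong-≗ λ u → trans (sum-cong-≗ λ v → cong 𝟙 (empty u v)) (sum-replicate-zero m))
               (sum-replicate-zero m))

arcless-clustersInV₂ : ∀ {n₁ n₂} (D : Compression (n₁ + n₂)) → (∀ u v → arc D u v ≡ false) → ClustersInV₂ n₁ n₂ D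
arcless-clustersInV₂ {n₁} D arcless v ¬inV₁ x p with ↑ˡ⊎↑ʳ n₁ x
... | inj₂ (j , x≡j) = j , x≡j
... | inj₁ (i , refl) = ⊥-elim (¬inV₁ (i , sym (Reach-from-sink (arcless v) p)))

normalise-optimal : ∀ {n₁ n₂} {E : Fin n₁ → Fin (suc n₂) → Bool} {D} → IsOptimal (bipartite n₁ (suc n₂) E) D →
  ∃[ D′ ] (IsOptimal (bipartite n₁ (suc n₂) E) D′ × ClustersInV₂ n₁ (suc n₂) D′)
normalise-optimal {E = E} (isD , D-minimal) =
  D′ , (D′-isDAGCompression , λ D″ isD″ → ≤-trans size-D′-≤ (D-minimal D″ isD″)) , D′-clustersInV₂
  where open Normalise E isD zero

lemma11 : ∀ (n₁ n₂ : ℕ) (E : Fin n₁ → Fin n₂ → Bool) →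
  ∃[ D ] (IsOptimal (bipartite n₁ n₂ E) D ×
    (∀ v → ¬ InV₁ n₁ n₂ D v → ∀ x → InCluster D x v → InV₂ n₁ n₂ x))
lemma11 n₁ zero E =
  trivial 𝐄 , (trivial-isDAGCompression 𝐄 , λ D _ → ≤-trans (≤-reflexive size≡0) z≤n) ,
  arcless-clustersInV₂ (trivial 𝐄) (λ _ _ → refl)
  where
  𝐄 = bipartite n₁ 0 E
  size≡0 : size (trivial 𝐄) ≡ 0
  size≡0 = cong₂ _+_ (card-empty (arc (trivial 𝐄)) (λ _ _ → refl))
                     (card-empty (cmp (trivial 𝐄)) (λ u v → bipartite-empty E (strip u) (strip v)))
lemma11 n₁ (suc n₂) E = normalise-optimal (proj₂ (optimal-exists (bipartite n₁ (suc n₂) E)))
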